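{- Fix an integer $R\ge1$ and an integer $n>R$ (with $n\ge 2$). Let $\alpha_{k,n}=\cos(2\pi k/n)$ for $1\le k\le n-1$ and \[ H_n(t)=\sum_{r\ge0}h_r(\alpha_{1,n},\dots,\alpha_{n-1,n})\,t^r=\prod_{k=1}^{n-1}\frac{1}{1-\alpha_{k,n}t}\in\mathbb{C}[[t]]. \] Let $A(t)=\dfrac{2}{1+\sqrt{1-t^2}}\in\mathbb{Q}[[t]]$. Then \[ H_n(t)\equiv(1-t)\,A(t)^n\pmod{t^{R+1}}. \]
   Context: $h_r(x_1,\dots,x_m)=\sum_{1\le i_1\le\cdots\le i_r\le m}x_{i_1}\cdots x_{i_r}$ is the complete homogeneous symmetric polynomial of degree $r$ ($h_0=1$). $\sqrt{1-t^2}$ denotes the formal power series with constant term $1$ whose square is $1-t^2$. -}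

module Defs where

open import Algebra.Bundles using (CommutativeRing)
import Level
open import Data.Nat using (ℕ; zero; suc; _∸_; _<_)
open import Data.List using (List; []; _∷_; applyUpTo)
open import Data.Product using (_×_; ∃)
open import Relation.Binary.PropositionalEquality using (_≡_)
open import Relation.Nullary using (¬_)

module Series {c ℓ} (F : CommutativeRing c ℓ) where
  open CommutativeRing F hiding (zero)

  pw : Carrier → ℕ → Carrier
  pw x zero    = 1#
  pw x (suc k) = x * pw x k

  ι : ℕ → Carrier
  ι zero    = 0#
  ι (suc m) = 1# + ι m

  IsField : Set (c Level.⊔ ℓ)
  IsField = (¬ (1# ≈ 0#)) × (∀ x → ¬ (x ≈ 0#) → ∃ λ y → x * y ≈ 1#)

  CharZero : Set ℓ
  CharZero = ∀ m → ι m ≈ 0# → m ≡ 0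

  PrimitiveRoot : ℕ → Carrier → Set ℓ
  PrimitiveRoot n ζ = (pw ζ n ≈ 1#) × (∀ k → 0 < k → k < n → ¬ (pw ζ k ≈ 1#))

  hom : ℕ → List Carrier → Carrier
  hom zero    _        = 1#
  hom (suc r) []       = 0#
  hom (suc r) (x ∷ xs) = hom (suc r) xs + x * hom r (x ∷ xs)

  -- α_{k,n} = cos(2πk/n) = (ζ^k + ζ^{-k})/2 with ζ = e^{2πi/n}, ζ^{-k} = ζ^{n-k};
  -- i2 plays the role of 1/2.
  α : Carrier → Carrier → ℕ → ℕ → Carrier
  α i2 ζ n k = i2 * (pw ζ k + pw ζ (n ∸ k))

  alphas : Carrier → Carrier → ℕ → List Carrier
  alphas i2 ζ n = applyUpTo (λ i → α i2 ζ n (suc i)) (n ∸ 1)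

  Ser : Set c
  Ser = ℕ → Carrier

  _≈ˢ_ : Ser → Ser → Set ℓ
  f ≈ˢ g = ∀ k → f k ≈ g k

  sumTo : (ℕ → Carrier) → ℕ → Carrier
  sumTo f zero    = f zero
  sumTo f (suc k) = sumTo f k + f (suc k)

  _⊛_ : Ser → Ser → Ser
  (f ⊛ g) k = sumTo (λ i → f i * g (k ∸ i)) k

  _⊕_ : Ser → Ser → Ser
  (f ⊕ g) k = f k + g k

  _⊖_ : Ser → Ser → Ser
  (f ⊖ g) k = f k - g k

  cst : Carrier → Ser
  cst x zero    = x
  cst x (suc k) = 0#

  mono : ℕ → Ser
  mono zero    zero    = 1#
  mono zero    (suc k) = 0#
  mono (suc j) zero    = 0#
  mono (suc j) (suc k) = mono j k

  _^ˢ_ : Ser → ℕ → Ser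
  f ^ˢ zero  = cst 1#
  f ^ˢ suc n = f ⊛ (f ^ˢ n)

{-# OPTIONS --safe #-}
-- Put y = −tA/2. From A(1 + s) = 2 and s² = 1 − t² one gets A = 1 + y² (indeed A(t) = C(t²/4)
-- for the Catalan series C = 1 + xC²), hence A·(1 − ½(a + b)t) = (1 + ay)(1 + by) whenever ab = 1.
-- Taking a = ζᵏ, b = ζ⁻ᵏ and adding the factor 1 − t = 1 − α₀t,
--   (1 − t)Aⁿ ∏_{0<k<n} (1 − αₖt) = ∏_{k<n} (1 + ζᵏy) · ∏_{k<n} (1 + ζ⁻ᵏy).
-- The elementary symmetric functions eⱼ(1, z, …, zⁿ⁻¹) of a primitive n-th root z vanish for
-- 0 < j < n, so each product on the right is 1 + c·yⁿ ≡ 1 (mod tⁿ), as t divides y. Since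
-- ∏ₖ (1 − αₖt) is the inverse of Hₙ(t), it follows that Hₙ(t) ≡ (1 − t)Aⁿ (mod tⁿ).
module Submission where

open import Defs
open import Algebra.Bundles using (CommutativeRing; RawRing)
import Algebra.Solver.Ring.AlmostCommutativeRing as ACR
open import Data.List using (List; []; _∷_; applyUpTo)
open import Data.Maybe using (Maybe; just; nothing)
open import Data.Nat as ℕ using (ℕ; zero; suc; _≤_; _<_; _∸_; z≤n; s≤s)
open import Data.Nat.Properties
  using (≤-refl; <⇒≤; ≮⇒≥; m≤n⇒m≤1+n; ≤-<-trans; <-≤-trans; +-monoˡ-≤;
         n∸n≡0; +-∸-assoc; ∸-+-assoc; m∸n+n≡m; m+[n∸m]≡n; m∸[m∸n]≡n; m≤n+o⇒m∸n≤o)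
open import Data.Product using (_×_; _,_; proj₁; proj₂; ∃)
open import Function using (_∘_)
open import Level using (0ℓ)
open import Relation.Binary.PropositionalEquality as ≡ using (_≡_)
open import Relation.Nullary using (¬_; yes; no)

-- Tactic.RingSolver over an arbitrary commutative ring cannot cancel x - x, since it cannot
-- decide whether a coefficient is zero; with integer coefficients it can.
module IntegerCoefficients {ℓ₁ ℓ₂} (R : CommutativeRing ℓ₁ ℓ₂) where
  open CommutativeRing R
  open import Algebra.Properties.Semiring.Mult.TCOptimised semiring as Mult using (1+×; ×-homo-+; ×1-homo-*)
  open import Algebra.Properties.Group +-group using (∙-cancelʳ)
  open import Algebra.Properties.CommutativeSemigroup +-commutativeSemigroup
    using (interchange; xy∙z≈xz∙y; x∙yz≈y∙xz)
  open import Algebra.Solver.Ring.NaturalCoefficients.Default commutativeSemiring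
    using () renaming (solve to semiring-solve; _:+_ to _⊕_; _:*_ to _⊗_; _:=_ to _⊜_)
  open import Relation.Binary.Reasoning.Setoid setoid

  private
    Differences : RawRing 0ℓ 0ℓ
    Differences = record
      { Carrier = ℕ × ℕ
      ; _≈_     = λ { (p , q) (r , s) → p ℕ.+ s ≡ r ℕ.+ q }
      ; _+_     = λ { (p , q) (r , s) → p ℕ.+ r , q ℕ.+ s }
      ; _*_     = λ { (p , q) (r , s) → p ℕ.* r ℕ.+ q ℕ.* s , p ℕ.* s ℕ.+ q ℕ.* r }
      ; -_      = λ { (p , q) → q , p }
      ; 0#      = 0 , 0
      ; 1#      = 1 , 0
      }

    [_] : ℕ → Carrier
    [ n ] = n Mult.× 1#

    -- Common successors are cancelled first, so pairs denoting the same integer evaluate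
    -- to the same closed term; this is what makes `solve … refl` succeed.
    ⟦_⟧ : ℕ × ℕ → Carrier
    ⟦ p     , zero  ⟧ = [ p ]
    ⟦ zero  , suc q ⟧ = - [ suc q ]
    ⟦ suc p , suc q ⟧ = ⟦ p , q ⟧

    ⟦⟧+[q]≈[p] : ∀ p q → ⟦ p , q ⟧ + [ q ] ≈ [ p ]
    ⟦⟧+[q]≈[p] p       zero    = +-identityʳ [ p ]
    ⟦⟧+[q]≈[p] zero    (suc q) = -‿inverseˡ [ suc q ]
    ⟦⟧+[q]≈[p] (suc p) (suc q) = begin
      ⟦ p , q ⟧ + [ suc q ]      ≈⟨ +-congˡ (1+× q 1#) ⟩
      ⟦ p , q ⟧ + (1# + [ q ])   ≈⟨ x∙yz≈y∙xz _ _ _ ⟩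
      1# + (⟦ p , q ⟧ + [ q ])   ≈⟨ +-congˡ (⟦⟧+[q]≈[p] p q) ⟩
      1# + [ p ]                 ≈⟨ 1+× p 1# ⟨
      [ suc p ]                  ∎

    ⟦⟧-unique : ∀ p q {x} → x + [ q ] ≈ [ p ] → ⟦ p , q ⟧ ≈ x
    ⟦⟧-unique p q x+[q]≈[p] = ∙-cancelʳ [ q ] _ _ (trans (⟦⟧+[q]≈[p] p q) (sym x+[q]≈[p]))

    +-homo : ∀ x y → ⟦ RawRing._+_ Differences x y ⟧ ≈ ⟦ x ⟧ + ⟦ y ⟧
    +-homo (p , q) (r , s) = ⟦⟧-unique (p ℕ.+ r) (q ℕ.+ s) (begin
      (⟦ p , q ⟧ + ⟦ r , s ⟧) + [ q ℕ.+ s ]     ≈⟨ +-congˡ (×-homo-+ 1# q s) ⟩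
      (⟦ p , q ⟧ + ⟦ r , s ⟧) + ([ q ] + [ s ]) ≈⟨ interchange _ _ _ _ ⟩
      (⟦ p , q ⟧ + [ q ]) + (⟦ r , s ⟧ + [ s ]) ≈⟨ +-cong (⟦⟧+[q]≈[p] p q) (⟦⟧+[q]≈[p] r s) ⟩
      [ p ] + [ r ]                             ≈⟨ ×-homo-+ 1# p r ⟨
      [ p ℕ.+ r ]                               ∎)

    *-homo : ∀ x y → ⟦ RawRing._*_ Differences x y ⟧ ≈ ⟦ x ⟧ * ⟦ y ⟧
    *-homo (p , q) (r , s) = ⟦⟧-unique (p ℕ.* r ℕ.+ q ℕ.* s) (p ℕ.* s ℕ.+ q ℕ.* r) (begin
      X * Y + [ p ℕ.* s ℕ.+ q ℕ.* r ]         ≈⟨ +-congˡ (bilinear p s q r) ⟩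
      X * Y + ([ p ] * S + Q * [ r ])         ≈⟨ +-congˡ (+-cong (*-congʳ [p]≈X+Q) (*-congˡ [r]≈Y+S)) ⟩
      X * Y + ((X + Q) * S + Q * (Y + S))     ≈⟨ semiring-solve 4 (λ X Y Q S →
                                                   X ⊗ Y ⊕ ((X ⊕ Q) ⊗ S ⊕ Q ⊗ (Y ⊕ S))
                                                     ⊜ (X ⊕ Q) ⊗ (Y ⊕ S) ⊕ Q ⊗ S)
                                                   refl X Y Q S ⟩
      (X + Q) * (Y + S) + Q * S               ≈⟨ +-congʳ (*-cong [p]≈X+Q [r]≈Y+S) ⟨
      [ p ] * [ r ] + Q * S                   ≈⟨ bilinear p r q s ⟨
      [ p ℕ.* r ℕ.+ q ℕ.* s ]                 ∎)
      where
      X Y Q S : Carrier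
      X = ⟦ p , q ⟧
      Y = ⟦ r , s ⟧
      Q = [ q ]
      S = [ s ]
      [p]≈X+Q : [ p ] ≈ X + Q
      [p]≈X+Q = sym (⟦⟧+[q]≈[p] p q)
      [r]≈Y+S : [ r ] ≈ Y + S
      [r]≈Y+S = sym (⟦⟧+[q]≈[p] r s)
      bilinear : ∀ a b c d → [ a ℕ.* b ℕ.+ c ℕ.* d ] ≈ [ a ] * [ b ] + [ c ] * [ d ]
      bilinear a b c d = trans (×-homo-+ 1# (a ℕ.* b) (c ℕ.* d)) (+-cong (×1-homo-* a b) (×1-homo-* c d))

    -‿homo : ∀ x → ⟦ RawRing.-_ Differences x ⟧ ≈ - ⟦ x ⟧
    -‿homo (p , q) = ⟦⟧-unique q p (begin
      - ⟦ p , q ⟧ + [ p ]                 ≈⟨ +-congˡ (⟦⟧+[q]≈[p] p q) ⟨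
      - ⟦ p , q ⟧ + (⟦ p , q ⟧ + [ q ])   ≈⟨ +-assoc _ _ _ ⟨
      (- ⟦ p , q ⟧ + ⟦ p , q ⟧) + [ q ]   ≈⟨ +-congʳ (-‿inverseˡ _) ⟩
      0# + [ q ]                           ≈⟨ +-identityˡ _ ⟩
      [ q ]                                ∎)

    homomorphism : Differences ACR.-Raw-AlmostCommutative⟶ ACR.fromCommutativeRing R
    homomorphism = record
      { ⟦_⟧    = ⟦_⟧
      ; +-homo = +-homo
      ; *-homo = *-homo
      ; -‿homo = -‿homo
      ; 0-homo = refl
      ; 1-homo = refl
      }

    ⟦⟧-cong : ∀ p q r s → p ℕ.+ s ≡ r ℕ.+ q → ⟦ p , q ⟧ ≈ ⟦ r , s ⟧
    ⟦⟧-cong p q r s p+s≡r+q = ∙-cancelʳ [ q ] _ _ (∙-cancelʳ [ s ] _ _ (begin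
      (⟦ p , q ⟧ + [ q ]) + [ s ]   ≈⟨ +-congʳ (⟦⟧+[q]≈[p] p q) ⟩
      [ p ] + [ s ]                 ≈⟨ ×-homo-+ 1# p s ⟨
      [ p ℕ.+ s ]                   ≡⟨ ≡.cong [_] p+s≡r+q ⟩
      [ r ℕ.+ q ]                   ≈⟨ ×-homo-+ 1# r q ⟩
      [ r ] + [ q ]                 ≈⟨ +-congʳ (⟦⟧+[q]≈[p] r s) ⟨
      (⟦ r , s ⟧ + [ s ]) + [ q ]   ≈⟨ xy∙z≈xz∙y _ _ _ ⟩
      (⟦ r , s ⟧ + [ q ]) + [ s ]   ∎))

    ⟦⟧-≟ : ∀ x y → Maybe (⟦ x ⟧ ≈ ⟦ y ⟧)
    ⟦⟧-≟ (p , q) (r , s) with p ℕ.+ s ℕ.≟ r ℕ.+ q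
    ... | yes p+s≡r+q = just (⟦⟧-cong p q r s p+s≡r+q)
    ... | no  _       = nothing

  open import Algebra.Solver.Ring Differences (ACR.fromCommutativeRing R) homomorphism ⟦⟧-≟ public

  lit : ∀ {n} → ℕ → Polynomial n
  lit k = con (k , 0)

module Sums {ℓ₁ ℓ₂} (R : CommutativeRing ℓ₁ ℓ₂) where
  open CommutativeRing R hiding (zero)
  open Series R using (sumTo)
  open import Algebra.Properties.CommutativeSemigroup +-commutativeSemigroup using (interchange)
  open import Relation.Binary.Reasoning.Setoid setoid

  sumTo-cong : ∀ {f g} k → (∀ i → i ≤ k → f i ≈ g i) → sumTo f k ≈ sumTo g k
  sumTo-cong zero    f≈g = f≈g 0 z≤n
  sumTo-cong (suc k) f≈g = +-cong (sumTo-cong k (λ i i≤k → f≈g i (m≤n⇒m≤1+n i≤k))) (f≈g (suc k) ≤-refl)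

  sumTo-distrib-+ : ∀ f g k → sumTo (λ i → f i + g i) k ≈ sumTo f k + sumTo g k
  sumTo-distrib-+ f g zero    = refl
  sumTo-distrib-+ f g (suc k) = trans (+-congʳ (sumTo-distrib-+ f g k)) (interchange _ _ _ _)

  *-distribˡ-sumTo : ∀ x f k → x * sumTo f k ≈ sumTo (λ i → x * f i) k
  *-distribˡ-sumTo x f zero    = refl
  *-distribˡ-sumTo x f (suc k) = trans (distribˡ x _ _) (+-congʳ (*-distribˡ-sumTo x f k))

  sumTo-uncons : ∀ f k → sumTo f (suc k) ≈ f 0 + sumTo (f ∘ suc) k
  sumTo-uncons f zero    = refl
  sumTo-uncons f (suc k) = trans (+-congʳ (sumTo-uncons f k)) (+-assoc _ _ _)

  sumTo-head : ∀ {f} k → (∀ i → i < k → f (suc i) ≈ 0#) → sumTo f k ≈ f 0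
  sumTo-head zero    _      = refl
  sumTo-head (suc k) tail≈0 =
    trans (+-cong (sumTo-head k (λ i i<k → tail≈0 i (m≤n⇒m≤1+n i<k))) (tail≈0 k ≤-refl)) (+-identityʳ _)

  sumTo-zero : ∀ {f} k → (∀ i → i ≤ k → f i ≈ 0#) → sumTo f k ≈ 0#
  sumTo-zero k f≈0 = trans (sumTo-head k (λ i → f≈0 (suc i))) (f≈0 0 z≤n)

  sumTo-reverse : ∀ f k → sumTo f k ≈ sumTo (λ i → f (k ∸ i)) k
  sumTo-reverse f zero    = refl
  sumTo-reverse f (suc k) = begin
    sumTo f (suc k)                        ≈⟨ sumTo-uncons f k ⟩
    f 0 + sumTo (f ∘ suc) k                ≈⟨ +-congˡ (sumTo-reverse (f ∘ suc) k) ⟩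
    f 0 + sumTo (λ i → f (suc (k ∸ i))) k  ≈⟨ +-comm _ _ ⟩
    sumTo (λ i → f (suc (k ∸ i))) k + f 0
      ≈⟨ +-cong (sumTo-cong k (λ i i≤k → reflexive (≡.cong f (≡.sym (+-∸-assoc 1 i≤k)))))
                (reflexive (≡.cong f (≡.sym (n∸n≡0 k)))) ⟩
    sumTo (λ i → f (suc k ∸ i)) (suc k)    ∎

  sumTo-triangle : ∀ (g : ℕ → ℕ → Carrier) k →
                   sumTo (λ m → sumTo (λ i → g i (m ∸ i)) m) k ≈ sumTo (λ i → sumTo (g i) (k ∸ i)) k
  sumTo-triangle g zero    = refl
  sumTo-triangle g (suc k) = begin
    sumTo (λ m → sumTo (λ i → g i (m ∸ i)) m) k + sumTo (λ i → g i (suc k ∸ i)) (suc k)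
      ≈⟨ +-congʳ (sumTo-triangle g k) ⟩
    sumTo (λ i → sumTo (g i) (k ∸ i)) k + (sumTo (λ i → g i (suc k ∸ i)) k + g (suc k) (k ∸ k))
      ≈⟨ +-assoc _ _ _ ⟨
    (sumTo (λ i → sumTo (g i) (k ∸ i)) k + sumTo (λ i → g i (suc k ∸ i)) k) + g (suc k) (k ∸ k)
      ≈⟨ +-congʳ (sumTo-distrib-+ _ _ k) ⟨
    sumTo (λ i → sumTo (g i) (k ∸ i) + g i (suc k ∸ i)) k + g (suc k) (k ∸ k)
      ≈⟨ +-cong (sumTo-cong k (λ i i≤k → +-congˡ (reflexive (≡.cong (g i) (+-∸-assoc 1 i≤k)))))
                (reflexive (≡.cong (g (suc k)) (n∸n≡0 k))) ⟩
    sumTo (λ i → sumTo (g i) (suc (k ∸ i))) k + g (suc k) 0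
      ≈⟨ +-cong (sumTo-cong k (λ i i≤k → reflexive (≡.cong (sumTo (g i)) (≡.sym (+-∸-assoc 1 i≤k)))))
                (reflexive (≡.cong (sumTo (g (suc k))) (≡.sym (n∸n≡0 k)))) ⟩
    sumTo (λ i → sumTo (g i) (suc k ∸ i)) (suc k)
      ∎

module Products {ℓ₁ ℓ₂} (R : CommutativeRing ℓ₁ ℓ₂) where
  open CommutativeRing R hiding (zero)
  open Series R using (pw)
  open import Algebra.Properties.CommutativeSemigroup *-commutativeSemigroup using (interchange)

  ∏ : (ℕ → Carrier) → ℕ → Carrier
  ∏ f zero    = 1#
  ∏ f (suc n) = f 0 * ∏ (f ∘ suc) n

  ∏-cong : ∀ {f g} n → (∀ k → k < n → f k ≈ g k) → ∏ f n ≈ ∏ g n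
  ∏-cong zero    _   = refl
  ∏-cong (suc n) f≈g = *-cong (f≈g 0 (s≤s z≤n)) (∏-cong n (λ k k<n → f≈g (suc k) (s≤s k<n)))

  ∏-distrib-* : ∀ f g n → ∏ (λ k → f k * g k) n ≈ ∏ f n * ∏ g n
  ∏-distrib-* f g zero    = sym (*-identityˡ 1#)
  ∏-distrib-* f g (suc n) = trans (*-congˡ (∏-distrib-* (f ∘ suc) (g ∘ suc) n)) (interchange _ _ _ _)

  ∏-const : ∀ x n → ∏ (λ _ → x) n ≡ pw x n
  ∏-const x zero    = ≡.refl
  ∏-const x (suc n) = ≡.cong (x *_) (∏-const x n)

module Identities {ℓ₁ ℓ₂} (R : CommutativeRing ℓ₁ ℓ₂) where
  open CommutativeRing R hiding (zero)
  open Series R using (IsField)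
  open IntegerCoefficients R using (solve; _:=_; _:+_; _:*_; _:-_; lit)
  open import Algebra.Properties.CommutativeSemigroup *-commutativeSemigroup using (x∙yz≈y∙xz)
  open import Relation.Binary.Reasoning.Setoid setoid

  inverse-unique : ∀ {x y z} → x * z ≈ 1# → y * z ≈ 1# → x ≈ y
  inverse-unique {x} {y} {z} xz≈1 yz≈1 = begin
    x            ≈⟨ *-identityʳ x ⟨
    x * 1#       ≈⟨ *-congˡ yz≈1 ⟨
    x * (y * z)  ≈⟨ x∙yz≈y∙xz x y z ⟩
    y * (x * z)  ≈⟨ *-congˡ xz≈1 ⟩
    y * 1#       ≈⟨ *-identityʳ y ⟩
    y            ∎

  inverse-perturbation : ∀ {x y z d} → x * y ≈ 1# → z * x ≈ 1# + d → y ≈ z - y * d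
  inverse-perturbation {x} {y} {z} {d} xy≈1 zx≈1+d = begin
    y                      ≈⟨ solve 2 (λ y d → y := (lit 1 :+ d) :* y :- y :* d) refl y d ⟩
    (1# + d) * y - y * d   ≈⟨ +-congʳ (*-congʳ zx≈1+d) ⟨
    z * x * y - y * d      ≈⟨ +-congʳ (*-assoc z x y) ⟩
    z * (x * y) - y * d    ≈⟨ +-congʳ (trans (*-congˡ xy≈1) (*-identityʳ z)) ⟩
    z - y * d              ∎

  quadratic-factorisation : ∀ {A y a b} → A ≈ 1# + y * y → a * b ≈ 1# →
                            A + (a + b) * y ≈ (1# + a * y) * (1# + b * y)
  quadratic-factorisation {A} {y} {a} {b} A≈1+y² ab≈1 = begin
    A + (a + b) * y                        ≈⟨ +-congʳ A≈1+y² ⟩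
    1# + y * y + (a + b) * y               ≈⟨ +-congʳ (+-congˡ (trans (*-congʳ ab≈1) (*-identityˡ _))) ⟨
    1# + a * b * (y * y) + (a + b) * y     ≈⟨ solve 3 (λ a b y → lit 1 :+ a :* b :* (y :* y) :+ (a :+ b) :* y
                                                         := (lit 1 :+ a :* y) :* (lit 1 :+ b :* y)) refl a b y ⟩
    (1# + a * y) * (1# + b * y)            ∎

  x*a≈a⇒a≈0 : IsField → ∀ {x a} → ¬ x ≈ 1# → x * a ≈ a → a ≈ 0#
  x*a≈a⇒a≈0 (_ , inverse) {x} {a} x≉1 xa≈a = begin
    a                  ≈⟨ *-identityˡ a ⟨
    1# * a             ≈⟨ *-congʳ [x-1]u≈1 ⟨
    (x - 1#) * u * a   ≈⟨ solve 3 (λ x u a → (x :- lit 1) :* u :* a := u :* (x :* a :- a)) refl x u a ⟩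
    u * (x * a - a)    ≈⟨ *-congˡ (+-congʳ xa≈a) ⟩
    u * (a - a)        ≈⟨ *-congˡ (-‿inverseʳ a) ⟩
    u * 0#             ≈⟨ zeroʳ u ⟩
    0#                 ∎
    where
    x-1≉0 : ¬ x - 1# ≈ 0#
    x-1≉0 x-1≈0 = x≉1 (begin
      x               ≈⟨ solve 1 (λ x → x := (x :- lit 1) :+ lit 1) refl x ⟩
      (x - 1#) + 1#   ≈⟨ +-congʳ x-1≈0 ⟩
      0# + 1#         ≈⟨ +-identityˡ 1# ⟩
      1#              ∎)
    u : Carrier
    u = proj₁ (inverse (x - 1#) x-1≉0)
    [x-1]u≈1 : (x - 1#) * u ≈ 1#
    [x-1]u≈1 = proj₂ (inverse (x - 1#) x-1≉0)

module Powers {ℓ₁ ℓ₂} (R : CommutativeRing ℓ₁ ℓ₂) where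
  open CommutativeRing R hiding (zero)
  open Series R using (pw; PrimitiveRoot)
  open Identities R using (inverse-unique)
  open import Algebra.Properties.CommutativeSemigroup *-commutativeSemigroup using (interchange)
  open import Relation.Binary.Reasoning.Setoid setoid

  pw-+ : ∀ x m n → pw x (m ℕ.+ n) ≈ pw x m * pw x n
  pw-+ x zero    n = sym (*-identityˡ _)
  pw-+ x (suc m) n = trans (*-congˡ (pw-+ x m n)) (sym (*-assoc _ _ _))

  pw-inverse : ∀ {x y} n → x * y ≈ 1# → pw x n * pw y n ≈ 1#
  pw-inverse zero    _    = *-identityˡ 1#
  pw-inverse (suc n) xy≈1 =
    trans (interchange _ _ _ _) (trans (*-cong xy≈1 (pw-inverse n xy≈1)) (*-identityˡ 1#))

  module _ {m z} (zⁿ≈1 : pw z (suc m) ≈ 1#) where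

    pw-pred-inverse : pw z m * z ≈ 1#
    pw-pred-inverse = trans (*-comm _ _) zⁿ≈1

    pw-∸-inverse : ∀ k → k ≤ suc m → pw z (suc m ∸ k) * pw z k ≈ 1#
    pw-∸-inverse k k≤n =
      trans (sym (pw-+ z (suc m ∸ k) k)) (trans (reflexive (≡.cong (pw z) (m∸n+n≡m k≤n))) zⁿ≈1)

    pw-complement : ∀ k → k ≤ suc m → pw z (suc m ∸ k) ≈ pw (pw z m) k
    pw-complement k k≤n = inverse-unique (pw-∸-inverse k k≤n) (pw-inverse k pw-pred-inverse)

  primitive-inverse : ∀ {m z} → PrimitiveRoot (suc m) z → PrimitiveRoot (suc m) (pw z m)
  primitive-inverse {m} {z} (zⁿ≈1 , zᵏ≉1) = z⁻¹ⁿ≈1 , λ k 0<k k<n z⁻¹ᵏ≈1 → zᵏ≉1 k 0<k k<n (begin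
      pw z k                    ≈⟨ *-identityˡ _ ⟨
      1# * pw z k               ≈⟨ *-congʳ z⁻¹ᵏ≈1 ⟨
      pw (pw z m) k * pw z k    ≈⟨ pw-inverse k (pw-pred-inverse {m} zⁿ≈1) ⟩
      1#                        ∎)
    where
    z⁻¹ⁿ≈1 : pw (pw z m) (suc m) ≈ 1#
    z⁻¹ⁿ≈1 = begin
      pw (pw z m) (suc m)                   ≈⟨ *-identityʳ _ ⟨
      pw (pw z m) (suc m) * 1#              ≈⟨ *-congˡ zⁿ≈1 ⟨
      pw (pw z m) (suc m) * pw z (suc m)    ≈⟨ pw-inverse (suc m) (pw-pred-inverse {m} zⁿ≈1) ⟩
      1#                                    ∎

module Elementary {ℓ₁ ℓ₂} (R : CommutativeRing ℓ₁ ℓ₂) where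
  open CommutativeRing R hiding (zero)
  open Series R using (pw; sumTo; PrimitiveRoot; IsField)
  open Sums R
  open Products R using (∏)
  open Identities R using (x*a≈a⇒a≈0)
  open IntegerCoefficients R using (solve; _:=_; _:+_; _:*_)
  open import Algebra.Properties.CommutativeSemigroup +-commutativeSemigroup using (xy∙z≈xz∙y)
  open import Algebra.Properties.Group +-group using (∙-cancelʳ)
  open import Relation.Binary.Reasoning.Setoid setoid

  e : ℕ → (ℕ → Carrier) → ℕ → Carrier
  e zero    f n       = 1#
  e (suc j) f zero    = 0#
  e (suc j) f (suc n) = e (suc j) (f ∘ suc) n + f 0 * e j (f ∘ suc) n

  e-snoc : ∀ j f n → e (suc j) f (suc n) ≈ e (suc j) f n + f n * e j f n
  e-snoc zero    f zero    = refl
  e-snoc (suc j) f zero    = refl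
  e-snoc zero    f (suc n) = trans (+-congʳ (e-snoc zero (f ∘ suc) n)) (xy∙z≈xz∙y _ _ _)
  e-snoc (suc j) f (suc n) = begin
    e (suc (suc j)) (f ∘ suc) (suc n) + f 0 * e (suc j) (f ∘ suc) (suc n)
      ≈⟨ +-cong (e-snoc (suc j) (f ∘ suc) n) (*-congˡ (e-snoc j (f ∘ suc) n)) ⟩
    (a + f (suc n) * b) + f 0 * (b + f (suc n) * c)
      ≈⟨ solve 5 (λ a b c x y → (a :+ y :* b) :+ x :* (b :+ y :* c) := (a :+ x :* b) :+ y :* (b :+ x :* c))
                 refl a b c (f 0) (f (suc n)) ⟩
    (a + f 0 * b) + f (suc n) * (b + f 0 * c)
      ∎
    where
    a b c : Carrier
    a = e (suc (suc j)) (f ∘ suc) n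
    b = e (suc j) (f ∘ suc) n
    c = e j (f ∘ suc) n

  e-scale : ∀ x f j n → e j (λ k → x * f k) n ≈ pw x j * e j f n
  e-scale x f zero    n       = sym (*-identityˡ 1#)
  e-scale x f (suc j) zero    = sym (zeroʳ _)
  e-scale x f (suc j) (suc n) = begin
    e (suc j) (λ k → x * f (suc k)) n + x * f 0 * e j (λ k → x * f (suc k)) n
      ≈⟨ +-cong (e-scale x (f ∘ suc) (suc j) n) (*-congˡ (e-scale x (f ∘ suc) j n)) ⟩
    x * pw x j * a + x * f 0 * (pw x j * b)
      ≈⟨ solve 5 (λ x p a y b → x :* p :* a :+ x :* y :* (p :* b) := x :* p :* (a :+ y :* b))
                 refl x (pw x j) a (f 0) b ⟩
    x * pw x j * (a + f 0 * b)
      ∎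
    where
    a b : Carrier
    a = e (suc j) (f ∘ suc) n
    b = e j (f ∘ suc) n

  -- Expanding e (suc j) (pw z) (suc n) along its first factor 1 (the others being z·zᵏ) gives
  -- zʲ⁺¹eⱼ₊₁ + zʲeⱼ; along its last factor zⁿ = 1 it gives eⱼ₊₁ + eⱼ.
  e-pw-fixed : ∀ {z n} → pw z n ≈ 1# → ∀ j → pw z j * e j (pw z) n ≈ e j (pw z) n
  e-pw-fixed zⁿ≈1 zero = *-identityˡ 1#
  e-pw-fixed {z} {n} zⁿ≈1 (suc j) = ∙-cancelʳ (pw z j * E j) _ _ (begin
    pw z (suc j) * E (suc j) + pw z j * E j
      ≈⟨ +-cong (e-scale z (pw z) (suc j) n) (e-scale z (pw z) j n) ⟨
    e (suc j) (pw z ∘ suc) n + e j (pw z ∘ suc) n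
      ≈⟨ +-congˡ (*-identityˡ _) ⟨
    e (suc j) (pw z) (suc n)      ≈⟨ e-snoc j (pw z) n ⟩
    E (suc j) + pw z n * E j      ≈⟨ +-congˡ (trans (*-congʳ zⁿ≈1) (*-identityˡ _)) ⟩
    E (suc j) + E j               ≈⟨ +-congˡ (e-pw-fixed zⁿ≈1 j) ⟨
    E (suc j) + pw z j * E j      ∎)
    where
    E : ℕ → Carrier
    E j = e j (pw z) n

  e-primitive-vanish : IsField → ∀ {n z} → PrimitiveRoot n z → ∀ j → 0 < j → j < n → e j (pw z) n ≈ 0#
  e-primitive-vanish isField (zⁿ≈1 , zʲ≉1) j 0<j j<n =
    x*a≈a⇒a≈0 isField (zʲ≉1 j 0<j j<n) (e-pw-fixed zⁿ≈1 j)

  -- Stated for every bound N ≥ n, so that the induction step can use the hypothesis at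
  -- both N and N − 1 without boundary terms.
  ∏-expansion : ∀ f y n N → n ≤ N → ∏ (λ k → 1# + f k * y) n ≈ sumTo (λ j → e j f n * pw y j) N
  ∏-expansion f y zero    N       _         = sym (trans (sumTo-head N (λ _ _ → zeroˡ _)) (*-identityˡ 1#))
  ∏-expansion f y (suc n) zero    ()
  ∏-expansion f y (suc n) (suc N) (s≤s n≤N) = sym (begin
    sumTo (λ j → e j f (suc n) * pw y j) (suc N)
      ≈⟨ sumTo-uncons _ N ⟩
    E 0 + sumTo (λ j → e (suc j) f (suc n) * (y * pw y j)) N
      ≈⟨ +-congˡ (sumTo-cong N (λ j _ → split j)) ⟩
    E 0 + sumTo (λ j → E (suc j) + c * E j) N
      ≈⟨ +-congˡ (sumTo-distrib-+ _ _ N) ⟩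
    E 0 + (sumTo (E ∘ suc) N + sumTo (λ j → c * E j) N)
      ≈⟨ +-assoc _ _ _ ⟨
    (E 0 + sumTo (E ∘ suc) N) + sumTo (λ j → c * E j) N
      ≈⟨ +-cong (sumTo-uncons E N) (*-distribˡ-sumTo c E N) ⟨
    sumTo E (suc N) + c * sumTo E N
      ≈⟨ +-cong (∏-expansion (f ∘ suc) y n (suc N) (m≤n⇒m≤1+n n≤N))
                (*-congˡ (∏-expansion (f ∘ suc) y n N n≤N)) ⟨
    P + c * P
      ≈⟨ +-congʳ (*-identityˡ P) ⟨
    1# * P + c * P
      ≈⟨ distribʳ P 1# c ⟨
    (1# + c) * P
      ∎)
    where
    c P : Carrier
    c = f 0 * y
    P = ∏ (λ k → 1# + f (suc k) * y) n
    E : ℕ → Carrier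
    E j = e j (f ∘ suc) n * pw y j
    split : ∀ j → e (suc j) f (suc n) * (y * pw y j) ≈ E (suc j) + c * E j
    split j = solve 5 (λ a x b y p → (a :+ x :* b) :* (y :* p) := a :* (y :* p) :+ x :* y :* (b :* p))
                refl (e (suc j) (f ∘ suc) n) (f 0) (e j (f ∘ suc) n) y (pw y j)

  ∏≈1+eyⁿ : ∀ f y m → (∀ j → j < m → e (suc j) f (suc m) ≈ 0#) →
            ∏ (λ k → 1# + f k * y) (suc m) ≈ 1# + e (suc m) f (suc m) * pw y (suc m)
  ∏≈1+eyⁿ f y m middle≈0 = trans (∏-expansion f y (suc m) (suc m) ≤-refl)
    (+-congʳ (trans (sumTo-head m (λ j j<m → trans (*-congʳ (middle≈0 j j<m)) (zeroˡ _))) (*-identityˡ 1#)))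

module PowerSeries {ℓ₁ ℓ₂} (F : CommutativeRing ℓ₁ ℓ₂) where
  open CommutativeRing F hiding (zero)
  open Series F
  open Sums F
  open import Algebra.Properties.CommutativeSemigroup *-commutativeSemigroup using (x∙yz≈y∙zx)
  open import Algebra.Properties.Ring ring using (-0#≈0#)
  open import Relation.Binary.Reasoning.Setoid setoid

  ⊛-cong : ∀ {f f′ g g′} → f ≈ˢ f′ → g ≈ˢ g′ → (f ⊛ g) ≈ˢ (f′ ⊛ g′)
  ⊛-cong f≈f′ g≈g′ k = sumTo-cong k (λ i _ → *-cong (f≈f′ i) (g≈g′ (k ∸ i)))

  ⊛-comm : ∀ f g → (f ⊛ g) ≈ˢ (g ⊛ f)
  ⊛-comm f g k = trans (sumTo-reverse _ k) (sumTo-cong k λ i i≤k →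
    trans (*-comm _ _) (*-congʳ (reflexive (≡.cong g (m∸[m∸n]≡n i≤k)))))

  ⊛-assoc : ∀ f g h → ((f ⊛ g) ⊛ h) ≈ˢ (f ⊛ (g ⊛ h))
  ⊛-assoc f g h k = begin
    sumTo (λ m → (f ⊛ g) m * h (k ∸ m)) k
      ≈⟨ sumTo-cong k (λ m _ → trans (*-comm _ _) (*-distribˡ-sumTo _ _ m)) ⟩
    sumTo (λ m → sumTo (λ i → h (k ∸ m) * (f i * g (m ∸ i))) m) k
      ≈⟨ sumTo-cong k (λ m _ → sumTo-cong m (λ i i≤m → trans (x∙yz≈y∙zx _ _ _)
           (*-congˡ (*-congˡ (reflexive (≡.cong (λ j → h (k ∸ j)) (≡.sym (m+[n∸m]≡n i≤m)))))))) ⟩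
    sumTo (λ m → sumTo (λ i → G i (m ∸ i)) m) k
      ≈⟨ sumTo-triangle G k ⟩
    sumTo (λ i → sumTo (G i) (k ∸ i)) k
      ≈⟨ sumTo-cong k (λ i _ → trans (sumTo-cong (k ∸ i) (λ j _ →
           *-congˡ (*-congˡ (reflexive (≡.cong h (≡.sym (∸-+-assoc k i j)))))))
           (sym (*-distribˡ-sumTo (f i) _ (k ∸ i)))) ⟩
    sumTo (λ i → f i * (g ⊛ h) (k ∸ i)) k
      ∎
    where
    G : ℕ → ℕ → Carrier
    G i j = f i * (g j * h (k ∸ (i ℕ.+ j)))

  ⊛-distribˡ-⊕ : ∀ f g h → (f ⊛ (g ⊕ h)) ≈ˢ ((f ⊛ g) ⊕ (f ⊛ h))
  ⊛-distribˡ-⊕ f g h k = trans (sumTo-cong k (λ i _ → distribˡ _ _ _)) (sumTo-distrib-+ _ _ k)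

  cst-⊛ : ∀ a f k → (cst a ⊛ f) k ≈ a * f k
  cst-⊛ a f k = sumTo-head k (λ i _ → zeroˡ _)

  SerRing : CommutativeRing ℓ₁ ℓ₂
  SerRing = record
    { Carrier = Ser
    ; _≈_ = _≈ˢ_
    ; _+_ = _⊕_
    ; _*_ = _⊛_
    ; -_ = λ f k → - f k
    ; 0# = cst 0#
    ; 1# = cst 1#
    ; isCommutativeRing = record
      { isRing = record
        { +-isAbelianGroup = record
          { isGroup = record
            { isMonoid = record
              { isSemigroup = record
                { isMagma = record
                  { isEquivalence = record
                    { refl  = λ _ → refl
                    ; sym   = λ f≈g k → sym (f≈g k)
                    ; trans = λ f≈g g≈h k → trans (f≈g k) (g≈h k)
                    }
                  ; ∙-cong = λ f≈f′ g≈g′ k → +-cong (f≈f′ k) (g≈g′ k) }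
                ; assoc = λ _ _ _ _ → +-assoc _ _ _ }
              ; identity = (λ { _ zero → +-identityˡ _ ; _ (suc _) → +-identityˡ _ })
                         , (λ { _ zero → +-identityʳ _ ; _ (suc _) → +-identityʳ _ }) }
            ; inverse = (λ { _ zero → -‿inverseˡ _ ; _ (suc _) → -‿inverseˡ _ })
                      , (λ { _ zero → -‿inverseʳ _ ; _ (suc _) → -‿inverseʳ _ })
            ; ⁻¹-cong = λ f≈g k → -‿cong (f≈g k) }
          ; comm = λ _ _ _ → +-comm _ _ }
        ; *-cong = ⊛-cong
        ; *-assoc = ⊛-assoc
        ; *-identity = (λ f k → trans (cst-⊛ 1# f k) (*-identityˡ _))
                     , (λ f k → trans (⊛-comm f (cst 1#) k) (trans (cst-⊛ 1# f k) (*-identityˡ _)))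
        ; distrib = ⊛-distribˡ-⊕
                  , (λ f g h k → trans (⊛-comm _ f k)
                                       (trans (⊛-distribˡ-⊕ f g h k) (+-cong (⊛-comm f g k) (⊛-comm f h k))))
        }
      ; *-comm = ⊛-comm
      }
    }

  module S = CommutativeRing SerRing
  open Products SerRing using (∏)
  open Elementary F using (e; e-primitive-vanish)
  module Eˢ = Elementary SerRing
  open IntegerCoefficients SerRing using (solve; _:=_; _:+_; _:*_; _:-_; lit)
  open import Algebra.Properties.CommutativeSemigroup S.*-commutativeSemigroup using (xy∙z≈y∙xz)

  cst-cong : ∀ {a b} → a ≈ b → cst a ≈ˢ cst b
  cst-cong a≈b zero    = a≈b
  cst-cong a≈b (suc k) = refl

  cst-+ : ∀ a b → cst (a + b) ≈ˢ (cst a ⊕ cst b)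
  cst-+ a b zero    = refl
  cst-+ a b (suc k) = sym (+-identityˡ 0#)

  cst-* : ∀ a b → cst (a * b) ≈ˢ (cst a ⊛ cst b)
  cst-* a b zero    = sym (cst-⊛ a (cst b) 0)
  cst-* a b (suc k) = sym (trans (cst-⊛ a (cst b) (suc k)) (zeroʳ a))

  mono1-⊛-zero : ∀ f → (mono 1 ⊛ f) 0 ≈ 0#
  mono1-⊛-zero f = zeroˡ (f 0)

  mono1-⊛-suc : ∀ f k → (mono 1 ⊛ f) (suc k) ≈ f k
  mono1-⊛-suc f k = trans (sumTo-uncons _ k)
    (trans (+-cong (zeroˡ _) (sumTo-head k (λ _ _ → zeroˡ _))) (trans (+-identityˡ _) (*-identityˡ _)))

  mono-suc : ∀ j → mono (suc j) ≈ˢ (mono 1 ⊛ mono j)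
  mono-suc j zero    = sym (mono1-⊛-zero (mono j))
  mono-suc j (suc k) = sym (mono1-⊛-suc (mono j) k)

  ^ˢ≡pw : ∀ f n → f ^ˢ n ≡ Series.pw SerRing f n
  ^ˢ≡pw f zero    = ≡.refl
  ^ˢ≡pw f (suc n) = ≡.cong (f ⊛_) (^ˢ≡pw f n)

  e-cst : ∀ j f n → Eˢ.e j (cst ∘ f) n ≈ˢ cst (e j f n)
  e-cst zero    f n       = S.refl
  e-cst (suc j) f zero    = S.refl
  e-cst (suc j) f (suc n) = S.trans (S.+-cong (e-cst (suc j) (f ∘ suc) n) (S.*-congˡ (e-cst j (f ∘ suc) n)))
                                    (S.sym (S.trans (cst-+ _ _) (S.+-congˡ (cst-* _ _))))

  ∏-roots-of-unity : IsField → ∀ {m z} → PrimitiveRoot (suc m) z → ∀ y →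
    ∏ (λ k → cst 1# ⊕ (cst (pw z k) ⊛ y)) (suc m)
      ≈ˢ (cst 1# ⊕ (cst (e (suc m) (pw z) (suc m)) ⊛ (y ^ˢ suc m)))
  ∏-roots-of-unity isField {m} {z} prim y = S.trans (Eˢ.∏≈1+eyⁿ (cst ∘ pw z) y m middle≈0)
    (S.+-congˡ (S.*-cong (e-cst (suc m) (pw z) (suc m)) (S.reflexive (≡.sym (^ˢ≡pw y (suc m))))))
    where
    middle≈0 : ∀ j → j < m → Eˢ.e (suc j) (cst ∘ pw z) (suc m) ≈ˢ cst 0#
    middle≈0 j j<m = S.trans (e-cst (suc j) (pw z) (suc m))
                             (cst-cong (e-primitive-vanish isField prim (suc j) (s≤s z≤n) (s≤s j<m)))

  infix 4 t^_∣_
  t^_∣_ : ℕ → Ser → Set ℓ₂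
  t^ n ∣ f = ∀ k → k < n → f k ≈ 0#

  t^0∣ : ∀ f → t^ 0 ∣ f
  t^0∣ f k ()

  ∣-⊛ : ∀ {m p f g} → t^ m ∣ f → t^ p ∣ g → t^ (m ℕ.+ p) ∣ (f ⊛ g)
  ∣-⊛ {m} {p} {f} {g} tᵐ∣f tᵖ∣g k k<m+p = sumTo-zero k term
    where
    term : ∀ i → i ≤ k → f i * g (k ∸ i) ≈ 0#
    term i i≤k with i ℕ.<? m
    ... | yes i<m = trans (*-congʳ (tᵐ∣f i i<m)) (zeroˡ _)
    ... | no  i≮m = trans (*-congˡ (tᵖ∣g (k ∸ i) k∸i<p)) (zeroʳ _)
      where
      k∸i<p : k ∸ i < p
      k∸i<p = ≡.subst (_≤ p) (+-∸-assoc 1 i≤k)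
                (m≤n+o⇒m∸n≤o (suc k) i (<-≤-trans k<m+p (+-monoˡ-≤ p (≮⇒≥ i≮m))))

  ∣-^ˢ : ∀ {y} → t^ 1 ∣ y → ∀ n → t^ n ∣ (y ^ˢ n)
  ∣-^ˢ t∣y zero    = t^0∣ _
  ∣-^ˢ t∣y (suc n) = ∣-⊛ t∣y (∣-^ˢ t∣y n)

  agree-below : ∀ {n f g d} → t^ n ∣ d → f ≈ˢ (g ⊖ d) → ∀ k → k < n → f k ≈ g k
  agree-below tⁿ∣d f≈g-d k k<n =
    trans (f≈g-d k) (trans (+-congˡ (trans (-‿cong (tⁿ∣d k k<n)) -0#≈0#)) (+-identityʳ _))

  lin : Carrier → Ser
  lin x = cst 1# ⊖ (cst x ⊛ mono 1)

  homˢ : List Carrier → Ser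
  homˢ xs r = hom r xs

  homˢ-∷ : ∀ x xs → homˢ (x ∷ xs) ≈ˢ (homˢ xs ⊕ (cst x ⊛ (mono 1 ⊛ homˢ (x ∷ xs))))
  homˢ-∷ x xs zero    = sym (trans (+-congˡ (trans (cst-⊛ x (mono 1 ⊛ h) 0)
                                                    (trans (*-congˡ (mono1-⊛-zero h)) (zeroʳ x))))
                                   (+-identityʳ 1#))
    where
    h : Ser
    h = homˢ (x ∷ xs)
  homˢ-∷ x xs (suc k) = sym (+-congˡ (trans (cst-⊛ x (mono 1 ⊛ h) (suc k)) (*-congˡ (mono1-⊛-suc h k))))
    where
    h : Ser
    h = homˢ (x ∷ xs)

  lin⊛homˢ : ∀ x xs → (lin x ⊛ homˢ (x ∷ xs)) ≈ˢ homˢ xs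
  lin⊛homˢ x xs = S.trans
    (solve 3 (λ c t h → (lit 1 :- c :* t) :* h := h :- c :* (t :* h)) S.refl (cst x) (mono 1) (homˢ (x ∷ xs)))
    (S.trans (S.+-congʳ (homˢ-∷ x xs))
             (solve 2 (λ h d → h :+ d :- d := h) S.refl (homˢ xs) (cst x ⊛ (mono 1 ⊛ homˢ (x ∷ xs)))))

  ∏lin⊛homˢ : ∀ f n → (∏ (lin ∘ f) n ⊛ homˢ (applyUpTo f n)) ≈ˢ cst 1#
  ∏lin⊛homˢ f zero    = S.trans (S.*-identityˡ (homˢ [])) λ { zero → refl ; (suc k) → refl }
  ∏lin⊛homˢ f (suc n) = S.trans
    (xy∙z≈y∙xz (lin (f 0)) (∏ (lin ∘ f ∘ suc) n) (homˢ (applyUpTo f (suc n))))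
    (S.trans (S.*-congˡ (lin⊛homˢ (f 0) (applyUpTo (f ∘ suc) n))) (∏lin⊛homˢ (f ∘ suc) n))

module CatalanSeries {ℓ₁ ℓ₂} (F : CommutativeRing ℓ₁ ℓ₂) where
  open CommutativeRing F hiding (zero)
  open Series F
  open PowerSeries F
  open Products SerRing using (∏; ∏-cong; ∏-distrib-*; ∏-const)
  open Powers F using (pw-∸-inverse; pw-complement; primitive-inverse)
  open Elementary F using (e)
  open Identities SerRing using (quadratic-factorisation)
  open IntegerCoefficients SerRing using (solve; _:=_; _:+_; _:*_; _:-_; :-_; lit)
  open import Algebra.Properties.CommutativeSemigroup S.*-commutativeSemigroup using (xy∙z≈y∙xz)
  open import Algebra.Properties.Ring ring using (-0#≈0#)
  open import Relation.Binary.Reasoning.Setoid S.setoid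

  module Solution (i2 : Carrier) (2i2≈1 : (1# + 1#) * i2 ≈ 1#)
                  (s : Ser) (s²≈1-t² : (s ⊛ s) ≈ˢ (cst 1# ⊖ mono 2))
                  (A : Ser) (A[1+s]≈2 : (A ⊛ (cst 1# ⊕ s)) ≈ˢ cst (1# + 1#)) where

    t I two y : Ser
    t = mono 1
    I = cst i2
    two = cst 1# ⊕ cst 1#
    y = S.- (I ⊛ (t ⊛ A))

    t∣y : t^ 1 ∣ y
    t∣y zero    _        =
      trans (-‿cong (trans (cst-⊛ i2 (t ⊛ A) 0) (trans (*-congˡ (mono1-⊛-zero A)) (zeroʳ i2)))) -0#≈0#
    t∣y (suc k) (s≤s ())

    two⊛I≈1 : (two ⊛ I) ≈ˢ cst 1#
    two⊛I≈1 =
      S.trans (S.*-congʳ {I} (S.sym (cst-+ 1# 1#))) (S.trans (S.sym (cst-* (1# + 1#) i2)) (cst-cong 2i2≈1))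

    A⊛s≈2-A : (A ⊛ s) ≈ˢ (two ⊖ A)
    A⊛s≈2-A = begin
      A ⊛ s                    ≈⟨ solve 2 (λ A s → A :* s := A :* (lit 1 :+ s) :- A) S.refl A s ⟩
      (A ⊛ (cst 1# ⊕ s)) ⊖ A   ≈⟨ S.+-congʳ (S.trans A[1+s]≈2 (cst-+ 1# 1#)) ⟩
      two ⊖ A                  ∎

    t²≈1-s² : (t ⊛ t) ≈ˢ (cst 1# ⊖ (s ⊛ s))
    t²≈1-s² = begin
      t ⊛ t                          ≈⟨ solve 1 (λ T → T := lit 1 :- (lit 1 :- T)) S.refl (t ⊛ t) ⟩
      cst 1# ⊖ (cst 1# ⊖ (t ⊛ t))    ≈⟨ S.+-congˡ (S.-‿cong (S.+-congˡ (S.-‿cong (mono-suc 1)))) ⟨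
      cst 1# ⊖ (cst 1# ⊖ mono 2)     ≈⟨ S.+-congˡ (S.-‿cong s²≈1-t²) ⟨
      cst 1# ⊖ (s ⊛ s)               ∎

    [tA]²≈4[A-1] : ((t ⊛ A) ⊛ (t ⊛ A)) ≈ˢ ((two ⊛ two) ⊛ (A ⊖ cst 1#))
    [tA]²≈4[A-1] = begin
      (t ⊛ A) ⊛ (t ⊛ A)
        ≈⟨ solve 2 (λ t A → (t :* A) :* (t :* A) := (t :* t) :* (A :* A)) S.refl t A ⟩
      (t ⊛ t) ⊛ (A ⊛ A)
        ≈⟨ S.*-congʳ {A ⊛ A} t²≈1-s² ⟩
      (cst 1# ⊖ (s ⊛ s)) ⊛ (A ⊛ A)
        ≈⟨ solve 2 (λ s A → (lit 1 :- s :* s) :* (A :* A) := A :* A :- (A :* s) :* (A :* s)) S.refl s A ⟩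
      (A ⊛ A) ⊖ ((A ⊛ s) ⊛ (A ⊛ s))
        ≈⟨ S.+-congˡ (S.-‿cong (S.*-cong A⊛s≈2-A A⊛s≈2-A)) ⟩
      (A ⊛ A) ⊖ ((two ⊖ A) ⊛ (two ⊖ A))
        ≈⟨ solve 1 (λ A → A :* A :- (lit 2 :- A) :* (lit 2 :- A) := (lit 2 :* lit 2) :* (A :- lit 1)) S.refl A ⟩
      (two ⊛ two) ⊛ (A ⊖ cst 1#)
        ∎

    A≈1+y² : A ≈ˢ (cst 1# ⊕ (y ⊛ y))
    A≈1+y² = S.sym (begin
      cst 1# ⊕ (y ⊛ y)
        ≈⟨ solve 2 (λ I T → lit 1 :+ (:- (I :* T)) :* (:- (I :* T)) := lit 1 :+ (I :* I) :* (T :* T))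
                   S.refl I (t ⊛ A) ⟩
      cst 1# ⊕ ((I ⊛ I) ⊛ ((t ⊛ A) ⊛ (t ⊛ A)))
        ≈⟨ S.+-congˡ (S.*-congˡ [tA]²≈4[A-1]) ⟩
      cst 1# ⊕ ((I ⊛ I) ⊛ ((two ⊛ two) ⊛ (A ⊖ cst 1#)))
        ≈⟨ solve 2 (λ I A → lit 1 :+ (I :* I) :* ((lit 2 :* lit 2) :* (A :- lit 1))
                            := lit 1 :+ ((lit 2 :* I) :* (lit 2 :* I)) :* (A :- lit 1)) S.refl I A ⟩
      cst 1# ⊕ (((two ⊛ I) ⊛ (two ⊛ I)) ⊛ (A ⊖ cst 1#))
        ≈⟨ S.+-congˡ (S.*-congʳ {A ⊖ cst 1#} (S.*-cong two⊛I≈1 two⊛I≈1)) ⟩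
      cst 1# ⊕ ((cst 1# ⊛ cst 1#) ⊛ (A ⊖ cst 1#))
        ≈⟨ solve 1 (λ A → lit 1 :+ (lit 1 :* lit 1) :* (A :- lit 1) := A) S.refl A ⟩
      A ∎)

    A⊛lin≈[1+ay][1+by] : ∀ {a b} → a * b ≈ 1# →
                         (A ⊛ lin (i2 * (a + b))) ≈ˢ ((cst 1# ⊕ (cst a ⊛ y)) ⊛ (cst 1# ⊕ (cst b ⊛ y)))
    A⊛lin≈[1+ay][1+by] {a} {b} ab≈1 = begin
      A ⊛ (cst 1# ⊖ (cst (i2 * (a + b)) ⊛ t))
        ≈⟨ S.*-congˡ {A} (S.+-congˡ {cst 1#} (S.-‿cong (S.*-congʳ {t} i2[a+b]≈I[a+b]))) ⟩
      A ⊛ (cst 1# ⊖ ((I ⊛ (cst a ⊕ cst b)) ⊛ t))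
        ≈⟨ solve 5 (λ A I a b t → A :* (lit 1 :- (I :* (a :+ b)) :* t) := A :+ (a :+ b) :* (:- (I :* (t :* A))))
                   S.refl A I (cst a) (cst b) t ⟩
      A ⊕ ((cst a ⊕ cst b) ⊛ y)
        ≈⟨ quadratic-factorisation A≈1+y² (S.trans (S.sym (cst-* a b)) (cst-cong ab≈1)) ⟩
      (cst 1# ⊕ (cst a ⊛ y)) ⊛ (cst 1# ⊕ (cst b ⊛ y))
        ∎
      where
      i2[a+b]≈I[a+b] : cst (i2 * (a + b)) ≈ˢ (I ⊛ (cst a ⊕ cst b))
      i2[a+b]≈I[a+b] = S.trans (cst-* i2 (a + b)) (S.*-congˡ (cst-+ a b))

    Aⁿ⊛∏lin≈1+Xyⁿ : IsField → ∀ {m ζ} → PrimitiveRoot (suc m) ζ →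
                    ∃ λ X → ((A ^ˢ suc m) ⊛ ∏ (lin ∘ α i2 ζ (suc m)) (suc m))
                              ≈ˢ (cst 1# ⊕ (X ⊛ (y ^ˢ suc m)))
    Aⁿ⊛∏lin≈1+Xyⁿ isField {m} {ζ} prim@(ζⁿ≈1 , _) = (c ⊕ c′) ⊕ ((c ⊛ c′) ⊛ yⁿ) , (begin
      (A ^ˢ n) ⊛ ∏ (lin ∘ α i2 ζ n) n
        ≡⟨ ≡.cong (_⊛ ∏ (lin ∘ α i2 ζ n) n) (≡.trans (^ˢ≡pw A n) (≡.sym (∏-const A n))) ⟩
      ∏ (λ _ → A) n ⊛ ∏ (lin ∘ α i2 ζ n) n
        ≈⟨ ∏-distrib-* (λ _ → A) (lin ∘ α i2 ζ n) n ⟨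
      ∏ (λ k → A ⊛ lin (α i2 ζ n k)) n
        ≈⟨ ∏-cong n factor ⟩
      ∏ (λ k → F₁ k ⊛ F₂ k) n
        ≈⟨ ∏-distrib-* F₁ F₂ n ⟩
      ∏ F₁ n ⊛ ∏ F₂ n
        ≈⟨ S.*-cong (∏-roots-of-unity isField prim y) (∏-roots-of-unity isField (primitive-inverse prim) y) ⟩
      (cst 1# ⊕ (c ⊛ yⁿ)) ⊛ (cst 1# ⊕ (c′ ⊛ yⁿ))
        ≈⟨ solve 3 (λ c c′ Y → (lit 1 :+ c :* Y) :* (lit 1 :+ c′ :* Y)
                               := lit 1 :+ ((c :+ c′) :+ (c :* c′) :* Y) :* Y) S.refl c c′ yⁿ ⟩
      cst 1# ⊕ (((c ⊕ c′) ⊕ ((c ⊛ c′) ⊛ yⁿ)) ⊛ yⁿ)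
        ∎)
      where
      n : ℕ
      n = suc m
      yⁿ c c′ : Ser
      yⁿ = y ^ˢ n
      c = cst (e n (pw ζ) n)
      c′ = cst (e n (pw (pw ζ m)) n)
      F₁ F₂ : ℕ → Ser
      F₁ k = cst 1# ⊕ (cst (pw ζ k) ⊛ y)
      F₂ k = cst 1# ⊕ (cst (pw (pw ζ m) k) ⊛ y)
      factor : ∀ k → k < n → (A ⊛ lin (α i2 ζ n k)) ≈ˢ (F₁ k ⊛ F₂ k)
      factor k k<n = S.trans (A⊛lin≈[1+ay][1+by] (trans (*-comm _ _) (pw-∸-inverse ζⁿ≈1 k (<⇒≤ k<n))))
        (S.*-congˡ {F₁ k} (S.+-congˡ {cst 1#} (S.*-congʳ {y} (cst-cong (pw-complement ζⁿ≈1 k (<⇒≤ k<n))))))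

    [1-t]Aⁿ⊛∏lin≈1+Xyⁿ : IsField → ∀ {m ζ} → PrimitiveRoot (suc m) ζ →
      ∃ λ X → (((cst 1# ⊖ t) ⊛ (A ^ˢ suc m)) ⊛ ∏ (lin ∘ α i2 ζ (suc m) ∘ suc) m)
                ≈ˢ (cst 1# ⊕ (X ⊛ (y ^ˢ suc m)))
    [1-t]Aⁿ⊛∏lin≈1+Xyⁿ isField {m} {ζ} prim@(ζⁿ≈1 , _) = X , (begin
      ((cst 1# ⊖ t) ⊛ (A ^ˢ n)) ⊛ P       ≈⟨ xy∙z≈y∙xz (cst 1# ⊖ t) (A ^ˢ n) P ⟩
      (A ^ˢ n) ⊛ ((cst 1# ⊖ t) ⊛ P)       ≈⟨ S.*-congˡ {A ^ˢ n} (S.*-congʳ {P} lin-α₀≈1-t) ⟨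
      (A ^ˢ n) ⊛ (lin (α i2 ζ n 0) ⊛ P)   ≈⟨ proj₂ (Aⁿ⊛∏lin≈1+Xyⁿ isField prim) ⟩
      cst 1# ⊕ (X ⊛ (y ^ˢ n))             ∎)
      where
      n : ℕ
      n = suc m
      P X : Ser
      P = ∏ (lin ∘ α i2 ζ n ∘ suc) m
      X = proj₁ (Aⁿ⊛∏lin≈1+Xyⁿ isField prim)
      lin-α₀≈1-t : lin (α i2 ζ n 0) ≈ˢ (cst 1# ⊖ t)
      lin-α₀≈1-t = S.+-congˡ {cst 1#} (S.-‿cong (S.trans
        (S.*-congʳ {t} (cst-cong (trans (*-congˡ (+-congˡ ζⁿ≈1)) (trans (*-comm _ _) 2i2≈1))))
        (S.*-identityˡ t)))

lemma9p8 : ∀ {c ℓ} (F : CommutativeRing c ℓ) →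
  let open CommutativeRing F
      open Series F
  in IsField → CharZero →
     (R n : ℕ) → 1 ≤ R → R < n → 2 ≤ n →
     (ζ : Carrier) → PrimitiveRoot n ζ →
     (i2 : Carrier) → (1# + 1#) * i2 ≈ 1# →
     (s : Ser) → s 0 ≈ 1# → (s ⊛ s) ≈ˢ (cst 1# ⊖ mono 2) →
     (A : Ser) → (A ⊛ (cst 1# ⊕ s)) ≈ˢ cst (1# + 1#) →
     (r : ℕ) → r ≤ R →
     hom r (alphas i2 ζ n) ≈ ((cst 1# ⊖ mono 1) ⊛ (A ^ˢ n)) r
lemma9p8 F isField _ R zero    _ ()  _ _ _    _  _      _ _ _        _ _        _ _
lemma9p8 F isField _ R (suc m) _ R<n _ ζ prim i2 2i2≈1 s _ s²≈1-t² A A[1+s]≈2 r r≤R =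
  agree-below tⁿ∣H⊛Xyⁿ (inverse-perturbation (∏lin⊛homˢ f m) GP≈1+Xyⁿ) r (≤-<-trans r≤R R<n)
  where
  open CommutativeRing F using (Carrier; 1#)
  open Series F using (Ser; _≈ˢ_; _⊛_; _⊕_; _⊖_; _^ˢ_; cst; mono; α)
  open PowerSeries F
  open Products SerRing using (∏)
  open Identities SerRing using (inverse-perturbation)
  open CatalanSeries.Solution F i2 2i2≈1 s s²≈1-t² A A[1+s]≈2
  f : ℕ → Carrier
  f = α i2 ζ (suc m) ∘ suc
  X : Ser
  X = proj₁ ([1-t]Aⁿ⊛∏lin≈1+Xyⁿ isField prim)
  GP≈1+Xyⁿ : (((cst 1# ⊖ mono 1) ⊛ (A ^ˢ suc m)) ⊛ ∏ (lin ∘ f) m) ≈ˢ (cst 1# ⊕ (X ⊛ (y ^ˢ suc m)))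
  GP≈1+Xyⁿ = proj₂ ([1-t]Aⁿ⊛∏lin≈1+Xyⁿ isField prim)
  tⁿ∣H⊛Xyⁿ : t^ suc m ∣ (homˢ (applyUpTo f m) ⊛ (X ⊛ (y ^ˢ suc m)))
  tⁿ∣H⊛Xyⁿ = ∣-⊛ (t^0∣ (homˢ (applyUpTo f m))) (∣-⊛ (t^0∣ X) (∣-^ˢ t∣y (suc m)))
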